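{- Fix $k\ge 4$ and $\ell\ge 2$. Let $A\subset\mathbb{R}^2$ have $n$ points, no $k$ collinear points, and no $\ell$ mutually visible points. If $n\ge 4(\ell-1)$, then there is a subset $A'\subset A$ with \[ |A'|\ge \frac{n}{8(\ell-1)\binom{k-2}{2}} \] such that every point of $A'$ is incident to at least \[ \frac{n}{24(\ell-1)\binom{k-2}{2}} \] distinct lines that contain at least three points of $A'$.
   Context: For $p,q\in\mathbb{R}^2$, $(pq)^\circ$ is the open segment joining them. Two points $p,q$ of a finite set $A\subset\mathbb{R}^2$ are visible in $A$ if $(pq)^\circ$ contains no point of $A$; a set of points of $A$ is mutually visible if every two of them are visible in $A$. -}

module Defs where

open import Level using (Level; suc; _⊔_)
open import Data.Nat using (ℕ)
open import Data.Fin using (Fin)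
open import Data.Fin.Subset using (Subset; _∈_)
open import Data.Product using (Σ; ∃; _×_; _,_)
open import Data.Sum using (_⊎_)
open import Relation.Binary.PropositionalEquality using (_≡_)
open import Relation.Nullary using (¬_)
open import Function.Definitions using (Injective)

-- An ordered field (all axioms stated with propositional equality).
-- The plane is F × F.  (ℝ is an instance.)
record OrderedField (c : Level) : Set (suc c) where
  infixl 6 _+_ _-_
  infixl 7 _*_
  infix 4 _<_
  field
    Carrier : Set c
    _+_ _*_ : Carrier → Carrier → Carrier
    -_ : Carrier → Carrier
    0# 1# : Carrier
    _<_ : Carrier → Carrier → Set c
    +-assoc : ∀ x y z → (x + y) + z ≡ x + (y + z)
    +-comm : ∀ x y → x + y ≡ y + x
    +-identityˡ : ∀ x → 0# + x ≡ x
    -‿inverseˡ : ∀ x → (- x) + x ≡ 0#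
    *-assoc : ∀ x y z → (x * y) * z ≡ x * (y * z)
    *-comm : ∀ x y → x * y ≡ y * x
    *-identityˡ : ∀ x → 1# * x ≡ x
    distribˡ : ∀ x y z → x * (y + z) ≡ (x * y) + (x * z)
    0≢1 : ¬ (0# ≡ 1#)
    *-inverse : ∀ x → ¬ (x ≡ 0#) → Σ Carrier (λ y → y * x ≡ 1#)
    <-irrefl : ∀ x → ¬ (x < x)
    <-trans : ∀ {x y z} → x < y → y < z → x < z
    <-tri : ∀ x y → (x < y) ⊎ ((x ≡ y) ⊎ (y < x))
    +-mono-< : ∀ {x y} z → x < y → x + z < y + z
    *-pos : ∀ {x y} → 0# < x → 0# < y → 0# < x * y

  _-_ : Carrier → Carrier → Carrier
  x - y = x + (- y)

module Geometry {c : Level} (F : OrderedField c) where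
  open OrderedField F

  Point : Set c
  Point = Carrier × Carrier

  InOpenSeg : Point → Point → Point → Set c
  InOpenSeg (px , py) (qx , qy) (rx , ry) =
    Σ Carrier λ t → (0# < t) × (t < 1#)
      × (rx ≡ ((1# - t) * px) + (t * qx))
      × (ry ≡ ((1# - t) * py) + (t * qy))

  CollinearFam : {m : ℕ} → (Fin m → Point) → Set c
  CollinearFam {m} f =
    Σ Carrier λ a → Σ Carrier λ b → Σ Carrier λ d →
      ¬ ((a ≡ 0#) × (b ≡ 0#)) ×
      (∀ (j : Fin m) → let (x , y) = f j in (a * x) + (b * y) ≡ d)

  Collinear3 : Point → Point → Point → Set c
  Collinear3 p q r =
    Σ Carrier λ a → Σ Carrier λ b → Σ Carrier λ d →
      ¬ ((a ≡ 0#) × (b ≡ 0#)) ×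
      (let (x₁ , y₁) = p in (a * x₁) + (b * y₁) ≡ d) ×
      (let (x₂ , y₂) = q in (a * x₂) + (b * y₂) ≡ d) ×
      (let (x₃ , y₃) = r in (a * x₃) + (b * y₃) ≡ d)

  -- A finite point set with n points is an injective family  A : Fin n → Point.

  Visible : {n : ℕ} → (Fin n → Point) → Point → Point → Set c
  Visible {n} A p q = ¬ (Σ (Fin n) λ r → InOpenSeg p q (A r))

  NoKCollinear : {n : ℕ} → ℕ → (Fin n → Point) → Set c
  NoKCollinear {n} k A =
    (f : Fin k → Fin n) → Injective _≡_ _≡_ f → ¬ CollinearFam (λ j → A (f j))

  NoLMutuallyVisible : {n : ℕ} → ℕ → (Fin n → Point) → Set c
  NoLMutuallyVisible {n} l A =
    (f : Fin l → Fin n) → Injective _≡_ _≡_ f →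
      ¬ (∀ i j → ¬ (i ≡ j) → Visible A (A (f i)) (A (f j)))

  -- Point A i (i ∈ A') is incident to at least m distinct lines each containing
  -- at least three points of A'.  Witnessed by m representatives b j ∈ A' (each
  -- spanning with A i a line that contains a third point c j ∈ A'), where the
  -- lines through A i and A (b j) are pairwise distinct (A i, A (b j), A (b j')
  -- not collinear for j ≠ j').
  IncidentRichLines : {n : ℕ} → (Fin n → Point) → Subset n → Fin n → ℕ → Set c
  IncidentRichLines {n} A A' i m =
    Σ (Fin m → Fin n) λ b → Σ (Fin m → Fin n) λ cc →
      (∀ j → b j ∈ A') × (∀ j → cc j ∈ A') ×
      (∀ j → ¬ (b j ≡ i)) × (∀ j → ¬ (cc j ≡ i)) × (∀ j → ¬ (b j ≡ cc j)) ×
      (∀ j → Collinear3 (A i) (A (b j)) (A (cc j))) ×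
      (∀ j j' → ¬ (j ≡ j') → ¬ Collinear3 (A i) (A (b j)) (A (b j')))

module Submission where

-- Join i and j when the line through A i and A j contains a third point of A. Two points that are
-- not joined see each other, so an independent set of size ℓ would be mutually visible, and
-- Turán's theorem (Caro–Wei form) gives n² ≤ (ℓ-1)(n + 2|E|); every edge lies in an ordered
-- collinear triple, so A spans many such triples. Deleting one by one the points lying on fewer
-- than n/(12(ℓ-1)) triples destroys fewer than n²/(4(ℓ-1)) triples, so the surviving set A'
-- still spans many of them; as two points lie on at most k-3 triples, A' is large. A surviving
-- point lies on at least n/(12(ℓ-1)) triples of A', and a rich line through it carries at most
-- (k-2)(k-3) of them, which bounds the number of rich lines through it from below.

open import Defs
open import Level using (Level)
open import Data.Nat as ℕ using (ℕ; zero; suc)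
open import Data.Fin as Fin using (Fin; zero; suc; toℕ)
import Data.Fin.Properties as Finₚ
open import Data.Integer as ℤ using (ℤ; -[1+_])
import Data.Integer.Properties as ℤₚ
import Data.Nat.Properties as ℕₚ
open import Data.Sign as Sign using (Sign)
open import Data.Maybe using (Maybe; just; nothing)
open import Data.Product using (Σ; ∃; _×_; _,_; proj₁; proj₂)
open import Data.Sum as Sum using (_⊎_; inj₁; inj₂)
open import Data.Empty using (⊥-elim)
open import Function using (_∘_; const; id; case_of_)
open import Function.Bundles using (mk⇔)
open import Function.Definitions using (Injective)
open import Relation.Nullary using (¬_; Dec; yes; no; does)
open import Relation.Nullary.Decidable using (_×-dec_; ¬?; dec-true; dec-false; does-⇔)
open import Relation.Binary.Definitions using (tri<; tri≈; tri>)
open import Relation.Binary.PropositionalEquality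
open import Algebra.Bundles using (CommutativeRing)
open import Algebra.Structures using (IsCommutativeRing)
open import Algebra.Solver.Ring.AlmostCommutativeRing using (fromCommutativeRing; _-Raw-AlmostCommutative⟶_)

module OrderedFieldProperties {c : Level} (F : OrderedField c) where
  open OrderedField F

  isCommutativeRing : IsCommutativeRing _≡_ _+_ _*_ -_ 0# 1#
  isCommutativeRing = record
    { isRing = record
      { +-isAbelianGroup = record
        { isGroup = record
          { isMonoid = record
            { isSemigroup = record
              { isMagma = record { isEquivalence = isEquivalence ; ∙-cong = cong₂ _+_ }
              ; assoc = +-assoc }
            ; identity = +-identityˡ , λ x → trans (+-comm x 0#) (+-identityˡ x) }
          ; inverse = -‿inverseˡ , λ x → trans (+-comm x (- x)) (-‿inverseˡ x)
          ; ⁻¹-cong = cong (λ x → - x) }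
        ; comm = +-comm }
      ; *-cong = cong₂ _*_
      ; *-assoc = *-assoc
      ; *-identity = *-identityˡ , λ x → trans (*-comm x 1#) (*-identityˡ x)
      ; distrib = distribˡ , λ x y z → trans (*-comm (y + z) x) (trans (distribˡ x y z) (cong₂ _+_ (*-comm x y) (*-comm x z))) }
    ; *-comm = *-comm }

  commutativeRing : CommutativeRing c c
  commutativeRing = record { isCommutativeRing = isCommutativeRing }

  open CommutativeRing commutativeRing using (+-identityʳ; -‿inverseʳ; zeroʳ; ring; semiring; +-monoid; +-abelianGroup; +-commutativeSemigroup)
  open import Algebra.Properties.Ring ring public using (-0#≈0#)
  open import Algebra.Properties.Ring ring using (-‿distribˡ-*; -‿distribʳ-*; -‿involutive)
  open import Algebra.Properties.AbelianGroup +-abelianGroup using (⁻¹-∙-comm; x∙y⁻¹≈ε⇒x≈y)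
  open import Algebra.Properties.CommutativeSemigroup +-commutativeSemigroup using (interchange)
  -- 1 ×′ x = x holds definitionally for the optimised multiple, so the solver's constant 1 is 1# itself
  open import Algebra.Properties.Monoid.Mult.TCOptimised +-monoid using (×-homo-+; 1+×) renaming (_×_ to _×′_)
  open import Algebra.Properties.Semiring.Mult.TCOptimised semiring using (×1-homo-*)

  -- The ring solver normalises coefficients by computation, which is impossible for abstract field
  -- elements; its coefficients are therefore taken in ℤ, embedded by ι.
  ι : ℤ → Carrier
  ι (ℤ.+ n) = n ×′ 1#
  ι -[1+ n ] = - (suc n ×′ 1#)

  ι-⊖ : ∀ m n → ι (m ℤ.⊖ n) ≡ m ×′ 1# - n ×′ 1#
  ι-⊖ m zero = sym (trans (cong ((m ×′ 1#) +_) -0#≈0#) (+-identityʳ _))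
  ι-⊖ zero (suc n) = sym (+-identityˡ _)
  ι-⊖ (suc m) (suc n) = begin
    ι (suc m ℤ.⊖ suc n)           ≡⟨ cong ι (ℤₚ.[1+m]⊖[1+n]≡m⊖n m n) ⟩
    ι (m ℤ.⊖ n)                   ≡⟨ ι-⊖ m n ⟩
    x - y                         ≡⟨ +-identityˡ (x - y) ⟨
    0# + (x - y)                  ≡⟨ cong (_+ (x - y)) (-‿inverseʳ 1#) ⟨
    (1# - 1#) + (x - y)           ≡⟨ interchange 1# (- 1#) x (- y) ⟩
    (1# + x) + (- 1# + - y)       ≡⟨ cong ((1# + x) +_) (⁻¹-∙-comm 1# y) ⟩
    (1# + x) - (1# + y)           ≡⟨ cong₂ _-_ (1+× m 1#) (1+× n 1#) ⟨
    suc m ×′ 1# - suc n ×′ 1#     ∎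
    where
    open ≡-Reasoning
    x = m ×′ 1#
    y = n ×′ 1#

  ι-+ : ∀ i j → ι (i ℤ.+ j) ≡ ι i + ι j
  ι-+ (ℤ.+ m) (ℤ.+ n) = ×-homo-+ 1# m n
  ι-+ (ℤ.+ m) -[1+ n ] = ι-⊖ m (suc n)
  ι-+ -[1+ m ] (ℤ.+ n) = trans (ι-⊖ n (suc m)) (+-comm _ _)
  ι-+ -[1+ m ] -[1+ n ] = begin
    - (suc (suc (m ℕ.+ n)) ×′ 1#)        ≡⟨ cong (λ k → - (suc k ×′ 1#)) (ℕₚ.+-suc m n) ⟨
    - ((suc m ℕ.+ suc n) ×′ 1#)          ≡⟨ cong (λ x → - x) (×-homo-+ 1# (suc m) (suc n)) ⟩
    - (suc m ×′ 1# + suc n ×′ 1#)        ≡⟨ ⁻¹-∙-comm _ _ ⟨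
    - (suc m ×′ 1#) + - (suc n ×′ 1#)    ∎
    where open ≡-Reasoning

  ι-neg : ∀ i → ι (ℤ.- i) ≡ - ι i
  ι-neg (ℤ.+ zero) = sym -0#≈0#
  ι-neg (ℤ.+ suc n) = refl
  ι-neg -[1+ n ] = sym (-‿involutive _)

  signed : Sign → Carrier → Carrier
  signed Sign.+ x = x
  signed Sign.- x = - x

  ι-◃ : ∀ s n → ι (s ℤ.◃ n) ≡ signed s (n ×′ 1#)
  ι-◃ Sign.+ zero = refl
  ι-◃ Sign.- zero = sym -0#≈0#
  ι-◃ Sign.+ (suc n) = refl
  ι-◃ Sign.- (suc n) = refl

  ι-signAbs : ∀ i → ι i ≡ signed (ℤ.sign i) (ℤ.∣ i ∣ ×′ 1#)
  ι-signAbs (ℤ.+ n) = refl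
  ι-signAbs -[1+ n ] = refl

  signed-* : ∀ s t x y → signed (s Sign.* t) (x * y) ≡ signed s x * signed t y
  signed-* Sign.+ Sign.+ x y = refl
  signed-* Sign.+ Sign.- x y = -‿distribʳ-* x y
  signed-* Sign.- Sign.+ x y = -‿distribˡ-* x y
  signed-* Sign.- Sign.- x y = begin
    x * y           ≡⟨ -‿involutive (x * y) ⟨
    - - (x * y)     ≡⟨ cong (λ z → - z) (-‿distribʳ-* x y) ⟩
    - (x * - y)     ≡⟨ -‿distribˡ-* x (- y) ⟩
    - x * - y       ∎
    where open ≡-Reasoning

  ι-* : ∀ i j → ι (i ℤ.* j) ≡ ι i * ι j
  ι-* i j = begin
    ι (s ℤ.◃ ∣i∣ ℕ.* ∣j∣)                                           ≡⟨ ι-◃ s (∣i∣ ℕ.* ∣j∣) ⟩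
    signed s ((∣i∣ ℕ.* ∣j∣) ×′ 1#)                                  ≡⟨ cong (signed s) (×1-homo-* ∣i∣ ∣j∣) ⟩
    signed s ((∣i∣ ×′ 1#) * (∣j∣ ×′ 1#))                            ≡⟨ signed-* (ℤ.sign i) (ℤ.sign j) _ _ ⟩
    signed (ℤ.sign i) (∣i∣ ×′ 1#) * signed (ℤ.sign j) (∣j∣ ×′ 1#)   ≡⟨ cong₂ _*_ (ι-signAbs i) (ι-signAbs j) ⟨
    ι i * ι j                                                       ∎
    where
    open ≡-Reasoning
    s = ℤ.sign i Sign.* ℤ.sign j
    ∣i∣ = ℤ.∣ i ∣
    ∣j∣ = ℤ.∣ j ∣

  ι-morphism : ℤ.+-*-rawRing -Raw-AlmostCommutative⟶ fromCommutativeRing commutativeRing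
  ι-morphism = record
    { ⟦_⟧ = ι ; +-homo = ι-+ ; *-homo = ι-* ; -‿homo = ι-neg ; 0-homo = refl ; 1-homo = refl }

  ι-≟ : ∀ i j → Maybe (ι i ≡ ι j)
  ι-≟ i j with i ℤ.≟ j
  ... | yes i≡j = just (cong ι i≡j)
  ... | no _ = nothing

  open import Algebra.Solver.Ring ℤ.+-*-rawRing (fromCommutativeRing commutativeRing) ι-morphism ι-≟ public
    using (solve; _:=_; _:+_; _:-_; _:*_; :-_; con)

  _≟ᶠ_ : (x y : Carrier) → Dec (x ≡ y)
  x ≟ᶠ y with <-tri x y
  ... | inj₁ x<y = no λ { refl → <-irrefl x x<y }
  ... | inj₂ (inj₁ x≡y) = yes x≡y
  ... | inj₂ (inj₂ y<x) = no λ { refl → <-irrefl x y<x }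

  x*y≡0⇒y≡0 : ∀ {x y} → x * y ≡ 0# → x ≢ 0# → y ≡ 0#
  x*y≡0⇒y≡0 {x} {y} xy≡0 x≢0 with *-inverse x x≢0
  ... | x⁻¹ , x⁻¹x≡1 = begin
    y                ≡⟨ *-identityˡ y ⟨
    1# * y           ≡⟨ cong (_* y) x⁻¹x≡1 ⟨
    (x⁻¹ * x) * y    ≡⟨ *-assoc x⁻¹ x y ⟩
    x⁻¹ * (x * y)    ≡⟨ cong (x⁻¹ *_) xy≡0 ⟩
    x⁻¹ * 0#         ≡⟨ zeroʳ x⁻¹ ⟩
    0#               ∎
    where open ≡-Reasoning

  x-y≡0⇒x≡y : ∀ {x y} → x - y ≡ 0# → x ≡ y
  x-y≡0⇒x≡y {x} {y} = x∙y⁻¹≈ε⇒x≈y x y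

  x-0≡x : ∀ x → x - 0# ≡ x
  x-0≡x x = trans (cong (x +_) -0#≈0#) (+-identityʳ x)

  x+y≡x⇒y≡0 : ∀ {x y} → x + y ≡ x → y ≡ 0#
  x+y≡x⇒y≡0 {x} {y} x+y≡x = begin
    y                  ≡⟨ cancel x y ⟩
    (x + y) - x        ≡⟨ cong (_- x) x+y≡x ⟩
    x - x              ≡⟨ -‿inverseʳ x ⟩
    0#                 ∎
    where
    open ≡-Reasoning
    cancel : ∀ x y → y ≡ (x + y) - x
    cancel = solve 2 (λ x y → y := (x :+ y) :- x) refl

module PlaneGeometry {c : Level} (F : OrderedField c) where
  open OrderedField F
  open OrderedFieldProperties F
  open Geometry F

  det : Point → Point → Point → Carrier
  det (px , py) (qx , qy) (rx , ry) = (qx - px) * (ry - py) - (qy - py) * (rx - px)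

  Col : Point → Point → Point → Set c
  Col p q r = det p q r ≡ 0#

  col? : ∀ p q r → Dec (Col p q r)
  col? p q r = det p q r ≟ᶠ 0#

  Col-swap : ∀ {p q r} → Col p q r → Col q p r
  Col-swap {px , py} {qx , qy} {rx , ry} pqr = begin
    det (qx , qy) (px , py) (rx , ry)     ≡⟨ alternating px py qx qy rx ry ⟩
    - det (px , py) (qx , qy) (rx , ry)   ≡⟨ cong (λ z → - z) pqr ⟩
    - 0#                                  ≡⟨ -0#≈0# ⟩
    0#                                    ∎
    where
    open ≡-Reasoning
    alternating : ∀ px py qx qy rx ry →
      (px - qx) * (ry - qy) - (py - qy) * (rx - qx) ≡ - ((qx - px) * (ry - py) - (qy - py) * (rx - px))
    alternating = solve 6 (λ px py qx qy rx ry →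
      (px :- qx) :* (ry :- qy) :- (py :- qy) :* (rx :- qx) := :- ((qx :- px) :* (ry :- py) :- (qy :- py) :* (rx :- px))) refl

  Col-rotate : ∀ {p q r} → Col p q r → Col q r p
  Col-rotate {px , py} {qx , qy} {rx , ry} = trans (cyclic px py qx qy rx ry)
    where
    cyclic : ∀ px py qx qy rx ry →
      (rx - qx) * (py - qy) - (ry - qy) * (px - qx) ≡ (qx - px) * (ry - py) - (qy - py) * (rx - px)
    cyclic = solve 6 (λ px py qx qy rx ry →
      (rx :- qx) :* (py :- qy) :- (ry :- qy) :* (px :- qx) := (qx :- px) :* (ry :- py) :- (qy :- py) :* (rx :- px)) refl

  Col-first : ∀ p q → Col p q p
  Col-first (px , py) (qx , qy) = degenerate px py qx qy
    where
    degenerate : ∀ px py qx qy → (qx - px) * (py - py) - (qy - py) * (px - px) ≡ 0#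
    degenerate = solve 4 (λ px py qx qy → (qx :- px) :* (py :- py) :- (qy :- py) :* (px :- px) := con (ℤ.+ 0)) refl

  Col-second : ∀ p q → Col p q q
  Col-second p q = Col-swap (Col-first q p)

  Line : Set c
  Line = Carrier × Carrier × Carrier

  OnLine : Line → Point → Set c
  OnLine (a , b , d) (x , y) = a * x + b * y ≡ d

  lineThrough : Point → Point → Line
  lineThrough (px , py) (qx , qy) = qy - py , px - qx , (qy - py) * px + (px - qx) * py

  lineThrough-nondegenerate : ∀ {p q} → p ≢ q → let (a , b , _) = lineThrough p q in ¬ ((a ≡ 0#) × (b ≡ 0#))
  lineThrough-nondegenerate {px , py} {qx , qy} p≢q (a≡0 , b≡0) =
    p≢q (cong₂ _,_ (x-y≡0⇒x≡y b≡0) (sym (x-y≡0⇒x≡y a≡0)))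

  Col⇒OnLine : ∀ {p q r} → Col p q r → OnLine (lineThrough p q) r
  Col⇒OnLine {px , py} {qx , qy} {rx , ry} pqr = begin
    (qy - py) * rx + (px - qx) * ry      ≡⟨ offset px py qx qy rx ry ⟩
    d - det (px , py) (qx , qy) (rx , ry) ≡⟨ cong (λ z → d - z) pqr ⟩
    d - 0#                               ≡⟨ x-0≡x d ⟩
    d                                    ∎
    where
    open ≡-Reasoning
    d = (qy - py) * px + (px - qx) * py
    offset : ∀ px py qx qy rx ry → (qy - py) * rx + (px - qx) * ry ≡
      ((qy - py) * px + (px - qx) * py) - ((qx - px) * (ry - py) - (qy - py) * (rx - px))
    offset = solve 6 (λ px py qx qy rx ry → (qy :- py) :* rx :+ (px :- qx) :* ry :=
      ((qy :- py) :* px :+ (px :- qx) :* py) :- ((qx :- px) :* (ry :- py) :- (qy :- py) :* (rx :- px))) refl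

  Col⇒Collinear3 : ∀ {p q r} → p ≢ q → Col p q r → Collinear3 p q r
  Col⇒Collinear3 {p} {q} p≢q pqr = let (a , b , d) = lineThrough p q in
    a , b , d , lineThrough-nondegenerate p≢q , refl , Col⇒OnLine (Col-second p q) , Col⇒OnLine pqr

  Col⇒CollinearFam : ∀ {m p q} {f : Fin m → Point} → p ≢ q → (∀ j → Col p q (f j)) → CollinearFam f
  Col⇒CollinearFam {p = p} {q} p≢q on-line = let (a , b , d) = lineThrough p q in
    a , b , d , lineThrough-nondegenerate p≢q , λ j → Col⇒OnLine (on-line j)

  private
    differences-vanish : ∀ u v {x y z d} → x ≡ d → y ≡ d → z ≡ d → u * (x - z) - v * (y - z) ≡ 0#
    differences-vanish u v {d = d} refl refl refl = vanish u v d
      where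
      vanish : ∀ u v d → u * (d - d) - v * (d - d) ≡ 0#
      vanish = solve 3 (λ u v d → u :* (d :- d) :- v :* (d :- d) := con (ℤ.+ 0)) refl

    -- With ℓ x = a * x₁ + b * x₂, both a * det p q r and b * det p q r are combinations of ℓ q - ℓ p and
    -- ℓ r - ℓ p, which vanish when p, q, r lie on the line ℓ = d; and a or b is nonzero.
    scaledˡ : ∀ a b px py qx qy rx ry → a * ((qx - px) * (ry - py) - (qy - py) * (rx - px)) ≡
      (ry - py) * ((a * qx + b * qy) - (a * px + b * py)) - (qy - py) * ((a * rx + b * ry) - (a * px + b * py))
    scaledˡ = solve 8 (λ a b px py qx qy rx ry → a :* ((qx :- px) :* (ry :- py) :- (qy :- py) :* (rx :- px)) :=
      (ry :- py) :* ((a :* qx :+ b :* qy) :- (a :* px :+ b :* py)) :- (qy :- py) :* ((a :* rx :+ b :* ry) :- (a :* px :+ b :* py))) refl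

    scaledʳ : ∀ a b px py qx qy rx ry → b * ((qx - px) * (ry - py) - (qy - py) * (rx - px)) ≡
      (qx - px) * ((a * rx + b * ry) - (a * px + b * py)) - (rx - px) * ((a * qx + b * qy) - (a * px + b * py))
    scaledʳ = solve 8 (λ a b px py qx qy rx ry → b :* ((qx :- px) :* (ry :- py) :- (qy :- py) :* (rx :- px)) :=
      (qx :- px) :* ((a :* rx :+ b :* ry) :- (a :* px :+ b :* py)) :- (rx :- px) :* ((a :* qx :+ b :* qy) :- (a :* px :+ b :* py))) refl

  Collinear3⇒Col : ∀ {p q r} → Collinear3 p q r → Col p q r
  Collinear3⇒Col {px , py} {qx , qy} {rx , ry} (a , b , d , nondegenerate , on-p , on-q , on-r) with a ≟ᶠ 0#
  ... | no a≢0 = x*y≡0⇒y≡0 (trans (scaledˡ a b px py qx qy rx ry) (differences-vanish (ry - py) (qy - py) on-q on-r on-p)) a≢0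
  ... | yes a≡0 = x*y≡0⇒y≡0 (trans (scaledʳ a b px py qx qy rx ry) (differences-vanish (qx - px) (rx - px) on-r on-q on-p))
                    (λ b≡0 → nondegenerate (a≡0 , b≡0))

  Col-trans : ∀ {p q x y} → p ≢ q → Col p q x → Col p q y → Col p x y
  Col-trans {p} {q} p≢q pqx pqy = let (a , b , d) = lineThrough p q in
    Collinear3⇒Col (a , b , d , lineThrough-nondegenerate p≢q , refl , Col⇒OnLine pqx , Col⇒OnLine pqy)

  InOpenSeg⇒Col : ∀ {p q r} → InOpenSeg p q r → Col p q r
  InOpenSeg⇒Col {px , py} {qx , qy} (t , _ , _ , refl , refl) = on-segment px py qx qy t
    where
    on-segment : ∀ px py qx qy t →
      (qx - px) * (((1# - t) * py + t * qy) - py) - (qy - py) * (((1# - t) * px + t * qx) - px) ≡ 0#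
    on-segment = solve 5 (λ px py qx qy t →
      (qx :- px) :* (((con (ℤ.+ 1) :- t) :* py :+ t :* qy) :- py) :- (qy :- py) :* (((con (ℤ.+ 1) :- t) :* px :+ t :* qx) :- px)
        := con (ℤ.+ 0)) refl

  InOpenSeg⇒≢ : ∀ {p q r} → p ≢ q → InOpenSeg p q r → r ≢ p × r ≢ q
  InOpenSeg⇒≢ {px , py} {qx , qy} p≢q (t , 0<t , t<1 , refl , refl) =
    (λ r≡p → p≢q (cong₂ _,_ (sym (at-p (cong proj₁ r≡p))) (sym (at-p (cong proj₂ r≡p))))) ,
    (λ r≡q → p≢q (cong₂ _,_ (at-q (cong proj₁ r≡q)) (at-q (cong proj₂ r≡q))))
    where
    t≢0 : t ≢ 0#
    t≢0 t≡0 = <-irrefl 0# (subst (0# <_) t≡0 0<t)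
    1-t≢0 : 1# - t ≢ 0#
    1-t≢0 1-t≡0 = <-irrefl t (subst (t <_) (x-y≡0⇒x≡y 1-t≡0) t<1)
    from-x : ∀ x y t → (1# - t) * x + t * y ≡ x + t * (y - x)
    from-x = solve 3 (λ x y t → (con (ℤ.+ 1) :- t) :* x :+ t :* y := x :+ t :* (y :- x)) refl
    from-y : ∀ x y t → (1# - t) * x + t * y ≡ y + (1# - t) * (x - y)
    from-y = solve 3 (λ x y t → (con (ℤ.+ 1) :- t) :* x :+ t :* y := y :+ (con (ℤ.+ 1) :- t) :* (x :- y)) refl
    at-p : ∀ {x y} → (1# - t) * x + t * y ≡ x → y ≡ x
    at-p {x} {y} r≡x = x-y≡0⇒x≡y (x*y≡0⇒y≡0 (x+y≡x⇒y≡0 (trans (sym (from-x x y t)) r≡x)) t≢0)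
    at-q : ∀ {x y} → (1# - t) * x + t * y ≡ y → x ≡ y
    at-q {x} {y} r≡y = x-y≡0⇒x≡y (x*y≡0⇒y≡0 (x+y≡x⇒y≡0 (trans (sym (from-y x y t)) r≡y)) 1-t≢0)

-- Data.Nat is opened only from here on: its operators and lemma names clash with the fields of OrderedField.
open import Data.Bool using (Bool; true; false; _∧_; not; if_then_else_)
import Data.Bool.Properties as Boolₚ
open Boolₚ using (∧-identityʳ; ∧-zeroʳ)
open import Data.Nat
open import Data.Nat.Properties
open import Data.Nat.Induction using (<-wellFounded)
open import Data.Nat.Combinatorics using (_C_; nC1≡n; nCk+nC[k+1]≡[n+1]C[k+1])
open import Data.Nat.Tactic.RingSolver using (solve-∀)
open import Data.Fin.Subset using (Subset; _∈_; ∣_∣)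
open import Data.Vec using (tabulate)
import Data.Vec.Properties as Vecₚ
open import Induction.WellFounded using (Acc; acc)
open import Algebra.Properties.Semiring.Sum +-*-semiring
  using (sum; sum-syntax; sum-cong-≗; sum-replicate-zero; ∑-distrib-+; ∑-comm; *-distribʳ-sum)

⟦_⟧ : Bool → ℕ
⟦ b ⟧ = if b then 1 else 0

-- Subsets of Fin n are Boolean predicates here (converted to Data.Fin.Subset only for the final
-- statement), so that sums over them are ordinary sums over Fin n.
module _ {n : ℕ} where

  infixl 10 sumOver
  infix 4 _⊆_
  infixl 7 _∩_
  infixl 6 _∖_ _─_

  _↾_ : (Fin n → ℕ) → (Fin n → Bool) → Fin n → ℕ
  (w ↾ P) j = if P j then w j else 0

  sumOver : (Fin n → Bool) → (Fin n → ℕ) → ℕ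
  sumOver P w = sum (w ↾ P)

  syntax sumOver P (λ j → w) = ∑[ j ∈ P ] w

  count : (Fin n → Bool) → ℕ
  count P = ∑[ j ∈ P ] 1

  _⊆_ : (Fin n → Bool) → (Fin n → Bool) → Set
  P ⊆ Q = ∀ j → P j ≡ true → Q j ≡ true

  _∩_ _∖_ : (Fin n → Bool) → (Fin n → Bool) → Fin n → Bool
  (P ∩ Q) j = P j ∧ Q j
  (P ∖ Q) j = P j ∧ not (Q j)

  ⁅_⁆ : Fin n → Fin n → Bool
  ⁅ i ⁆ j = does (i Fin.≟ j)

  _─_ : (Fin n → Bool) → Fin n → Fin n → Bool
  P ─ i = P ∖ ⁅ i ⁆

∧-true⁻ : ∀ {a b} → a ∧ b ≡ true → a ≡ true × b ≡ true
∧-true⁻ {true} b≡true = refl , b≡true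

∧-true : ∀ {a b} → a ≡ true → b ≡ true → a ∧ b ≡ true
∧-true refl b≡true = b≡true

not-true : ∀ {a} → not a ≡ true → a ≡ false
not-true {false} _ = refl

does-true⇒ : ∀ {a} {X : Set a} (x? : Dec X) → does x? ≡ true → X
does-true⇒ (yes x) _ = x

does-false⇒ : ∀ {a} {X : Set a} (x? : Dec X) → does x? ≡ false → ¬ X
does-false⇒ (no ¬x) _ = ¬x

⟦0<?⟧≤ : ∀ c → ⟦ does (0 <? c) ⟧ ≤ c
⟦0<?⟧≤ zero = z≤n
⟦0<?⟧≤ (suc c) = s≤s z≤n

⟦⟧≤ : ∀ {b x} → (b ≡ true → 1 ≤ x) → ⟦ b ⟧ ≤ x
⟦⟧≤ {true} 1≤x = 1≤x refl
⟦⟧≤ {false} _ = z≤n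

≤-if-positive : ∀ {c b} → c ≤ b → c ≤ (if does (0 <? c) then b else 0)
≤-if-positive {zero} _ = z≤n
≤-if-positive {suc c} c≤b = c≤b

sum-mono-≤ : ∀ {n} {f g : Fin n → ℕ} → (∀ i → f i ≤ g i) → sum f ≤ sum g
sum-mono-≤ {zero} f≤g = z≤n
sum-mono-≤ {suc n} {f} {g} f≤g = +-mono-≤ (f≤g zero) (sum-mono-≤ {f = f ∘ suc} {g ∘ suc} (f≤g ∘ suc))

sum-const : ∀ n c → ∑[ i < n ] c ≡ n * c
sum-const zero c = refl
sum-const (suc n) c = cong (c +_) (sum-const n c)

term≤sum : ∀ {n} (f : Fin n → ℕ) i → f i ≤ sum f
term≤sum f zero = m≤m+n _ _
term≤sum f (suc i) = ≤-trans (term≤sum (f ∘ suc) i) (m≤n+m _ _)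

sumOver-⁅⁆ : ∀ {n} (P : Fin n → Bool) i w → sumOver (P ∩ ⁅ i ⁆) w ≡ (w ↾ P) i
sumOver-⁅⁆ {suc n} P zero w = begin
    (w ↾ (P ∩ ⁅ zero ⁆)) zero + sum ((w ∘ suc) ↾ (λ j → P (suc j) ∧ false))
  ≡⟨ cong₂ _+_ (cong (λ b → if b then w zero else 0) (∧-identityʳ (P zero)))
               (sum-cong-≗ (λ j → cong (λ b → if b then w (suc j) else 0) (∧-zeroʳ (P (suc j))))) ⟩
    (w ↾ P) zero + sum {n} (const 0)
  ≡⟨ cong ((w ↾ P) zero +_) (sum-replicate-zero n) ⟩
    (w ↾ P) zero + 0
  ≡⟨ +-identityʳ _ ⟩
    (w ↾ P) zero ∎
  where open ≡-Reasoning
sumOver-⁅⁆ {suc n} P (suc i) w =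
  cong₂ _+_ (cong (λ b → if b then w zero else 0) (∧-zeroʳ (P zero))) (sumOver-⁅⁆ (P ∘ suc) i (w ∘ suc))

module _ {n : ℕ} where

  ∩-⊆ˡ : ∀ (P Q : Fin n → Bool) → (P ∩ Q) ⊆ P
  ∩-⊆ˡ P Q j = proj₁ ∘ ∧-true⁻

  ∩-⊆ʳ : ∀ (P Q : Fin n → Bool) → (P ∩ Q) ⊆ Q
  ∩-⊆ʳ P Q j = proj₂ ∘ ∧-true⁻

  ∖-⊆ : ∀ (P Q : Fin n → Bool) → (P ∖ Q) ⊆ P
  ∖-⊆ P Q j = proj₁ ∘ ∧-true⁻

  ∩-monoˡ : ∀ {P P′} (Q : Fin n → Bool) → P ⊆ P′ → (P ∩ Q) ⊆ (P′ ∩ Q)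
  ∩-monoˡ Q P⊆P′ j PQj = let (Pj , Qj) = ∧-true⁻ PQj in ∧-true (P⊆P′ j Pj) Qj

  ∖-member : ∀ (P Q : Fin n → Bool) {j} → (P ∖ Q) j ≡ true → P j ≡ true × Q j ≡ false
  ∖-member P Q PQj = let (Pj , ¬Qj) = ∧-true⁻ PQj in Pj , not-true ¬Qj

  ─-member : ∀ (P : Fin n → Bool) i {j} → (P ─ i) j ≡ true → P j ≡ true × i ≢ j
  ─-member P i {j} Pj with i Fin.≟ j
  ... | yes refl with () ← proj₂ (∧-true⁻ {P j} Pj)
  ... | no i≢j = proj₁ (∧-true⁻ Pj) , i≢j

  ─-intro : ∀ (P : Fin n → Bool) {i j} → P j ≡ true → i ≢ j → (P ─ i) j ≡ true
  ─-intro P {i} {j} Pj i≢j rewrite Pj | dec-false (i Fin.≟ j) i≢j = refl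

  ─∩-absent : ∀ (P Q : Fin n → Bool) {i} → Q i ≡ false → ∀ j → ((P ─ i) ∩ Q) j ≡ (P ∩ Q) j
  ─∩-absent P Q {i} Qi j with i Fin.≟ j
  ... | yes refl rewrite Qi = trans (∧-zeroʳ _) (sym (∧-zeroʳ _))
  ... | no _ = cong (_∧ Q j) (∧-identityʳ (P j))

  ↾-member : ∀ (w : Fin n → ℕ) (P : Fin n → Bool) {i} → P i ≡ true → (w ↾ P) i ≡ w i
  ↾-member w P {i} Pi = cong (λ b → if b then w i else 0) Pi

  sumOver-cong : ∀ {P Q : Fin n → Bool} (w : Fin n → ℕ) → (∀ j → P j ≡ Q j) → sumOver P w ≡ sumOver Q w
  sumOver-cong w P≗Q = sum-cong-≗ (λ j → cong (λ b → if b then w j else 0) (P≗Q j))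

  sumOver-mono-≤ : ∀ {P Q : Fin n → Bool} {w w′ : Fin n → ℕ} →
    P ⊆ Q → (∀ j → P j ≡ true → w j ≤ w′ j) → sumOver P w ≤ sumOver Q w′
  sumOver-mono-≤ {P} {Q} {w} {w′} P⊆Q w≤w′ = sum-mono-≤ pointwise
    where
    pointwise : ∀ j → (w ↾ P) j ≤ (w′ ↾ Q) j
    pointwise j with P j in Pj
    ... | false = z≤n
    ... | true rewrite P⊆Q j Pj = w≤w′ j Pj

  count-mono-≤ : ∀ {P Q : Fin n → Bool} → P ⊆ Q → count P ≤ count Q
  count-mono-≤ P⊆Q = sumOver-mono-≤ P⊆Q (λ _ _ → ≤-refl)

  sumOver≤sum : ∀ (P : Fin n → Bool) w → sumOver P w ≤ sum w
  sumOver≤sum P w = sum-mono-≤ pointwise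
    where
    pointwise : ∀ j → (w ↾ P) j ≤ w j
    pointwise j with P j
    ... | true = ≤-refl
    ... | false = z≤n

  member⇒count-pos : ∀ (P : Fin n → Bool) {i} → P i ≡ true → 0 < count P
  member⇒count-pos P {i} Pi = ≤-trans (≤-reflexive (sym (↾-member (const 1) P Pi))) (term≤sum (const 1 ↾ P) i)

  sumOver-+ : ∀ (P : Fin n → Bool) (w w′ : Fin n → ℕ) →
    ∑[ j ∈ P ] (w j + w′ j) ≡ sumOver P w + sumOver P w′
  sumOver-+ P w w′ = trans (sum-cong-≗ pointwise) (∑-distrib-+ (w ↾ P) (w′ ↾ P))
    where
    pointwise : ∀ j → ((λ j → w j + w′ j) ↾ P) j ≡ (w ↾ P) j + (w′ ↾ P) j
    pointwise j with P j
    ... | true = refl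
    ... | false = refl

  sumOver-const : ∀ (P : Fin n → Bool) c → ∑[ j ∈ P ] c ≡ count P * c
  sumOver-const P c = trans (sum-cong-≗ pointwise) (sym (*-distribʳ-sum c (const 1 ↾ P)))
    where
    pointwise : ∀ j → (const c ↾ P) j ≡ (const 1 ↾ P) j * c
    pointwise j with P j
    ... | true = sym (+-identityʳ c)
    ... | false = refl

  sumOver-split : ∀ (P Q : Fin n → Bool) w → sumOver P w ≡ sumOver (P ∖ Q) w + sumOver (P ∩ Q) w
  sumOver-split P Q w = trans (sum-cong-≗ pointwise) (∑-distrib-+ (w ↾ (P ∖ Q)) (w ↾ (P ∩ Q)))
    where
    pointwise : ∀ j → (w ↾ P) j ≡ (w ↾ (P ∖ Q)) j + (w ↾ (P ∩ Q)) j
    pointwise j with P j | Q j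
    ... | true | true = refl
    ... | true | false = sym (+-identityʳ _)
    ... | false | _ = refl

  sumOver-∩ : ∀ (P Q : Fin n → Bool) w → sumOver (P ∩ Q) w ≡ ∑[ j ∈ P ] (w ↾ Q) j
  sumOver-∩ P Q w = sum-cong-≗ (λ j → if-∧ (P j) (Q j))
    where
    if-∧ : ∀ a b {x} → (if a ∧ b then x else 0) ≡ (if a then (if b then x else 0) else 0)
    if-∧ true b = refl
    if-∧ false b = refl

  sumOver-⟦⟧ : ∀ (P Q : Fin n → Bool) → ∑[ j ∈ P ] ⟦ Q j ⟧ ≡ count (P ∩ Q)
  sumOver-⟦⟧ P Q = sum-cong-≗ pointwise
    where
    pointwise : ∀ j → ((λ j → ⟦ Q j ⟧) ↾ P) j ≡ (const 1 ↾ (P ∩ Q)) j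
    pointwise j with P j
    ... | true = refl
    ... | false = refl

  sumOver-─ : ∀ (P : Fin n → Bool) i w → sumOver P w ≡ sumOver (P ─ i) w + (w ↾ P) i
  sumOver-─ P i w = trans (sumOver-split P ⁅ i ⁆ w) (cong (sumOver (P ─ i) w +_) (sumOver-⁅⁆ P i w))

  sumOver-─≤ : ∀ (P : Fin n → Bool) i w → sumOver P w ≤ sumOver (P ─ i) w + w i
  sumOver-─≤ P i w = subst (_≤ sumOver (P ─ i) w + w i) (sym (sumOver-─ P i w)) (+-monoʳ-≤ (sumOver (P ─ i) w) ↾≤)
    where
    ↾≤ : (w ↾ P) i ≤ w i
    ↾≤ with P i
    ... | true = ≤-refl
    ... | false = z≤n

  count-─ : ∀ (P : Fin n → Bool) {i} → P i ≡ true → count P ≡ suc (count (P ─ i))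
  count-─ P {i} Pi = trans (sumOver-─ P i (const 1)) (trans (cong (count (P ─ i) +_) (↾-member (const 1) P Pi)) (+-comm _ 1))

  sum-sumOver-comm : ∀ {m} (P : Fin n → Bool) (w : Fin m → Fin n → ℕ) →
    ∑[ i < m ] sumOver P (w i) ≡ ∑[ j ∈ P ] ∑[ i < m ] w i j
  sum-sumOver-comm {m} P w = trans (∑-comm (λ i → w i ↾ P)) (sum-cong-≗ pointwise)
    where
    pointwise : ∀ j → ∑[ i < m ] (w i ↾ P) j ≡ ((λ j → ∑[ i < m ] w i j) ↾ P) j
    pointwise j with P j
    ... | true = refl
    ... | false = sum-replicate-zero m

≤count⇒injection : ∀ {n k} (P : Fin n → Bool) → k ≤ count P →
  Σ (Fin k → Fin n) λ f → Injective _≡_ _≡_ f × (∀ a → P (f a) ≡ true)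
≤count⇒injection {k = zero} P _ = (λ ()) , (λ { {()} }) , (λ ())
≤count⇒injection {suc n} {suc k} P k<count with P zero in P0
... | false = let (f , f-injective , Pf) = ≤count⇒injection (P ∘ suc) k<count in
  suc ∘ f , (λ e → f-injective (Finₚ.suc-injective e)) , Pf
... | true = let (f , f-injective , Pf) = ≤count⇒injection (P ∘ suc) (s≤s⁻¹ k<count) in
  g f , g-injective f-injective , Pg Pf
  where
  g : (Fin k → Fin n) → Fin (suc k) → Fin (suc n)
  g f zero = zero
  g f (suc a) = suc (f a)
  g-injective : ∀ {f} → Injective _≡_ _≡_ f → Injective _≡_ _≡_ (g f)
  g-injective f-inj {zero} {zero} _ = refl
  g-injective f-inj {suc a} {suc b} e = cong suc (f-inj (Finₚ.suc-injective e))
  Pg : ∀ {f} → (∀ a → P (suc (f a)) ≡ true) → ∀ a → P (g f a) ≡ true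
  Pg Pf zero = P0
  Pg Pf (suc a) = Pf a

count-pos⇒∃ : ∀ {n} (P : Fin n → Bool) → 0 < count P → ∃ λ i → P i ≡ true
count-pos⇒∃ P 0<count = let (f , _ , Pf) = ≤count⇒injection P 0<count in f zero , Pf zero

argmin : ∀ {n} (g : Fin n → ℕ) (P : Fin n → Bool) {i} → P i ≡ true →
  Σ (Fin n) λ v → P v ≡ true × (∀ j → P j ≡ true → g v ≤ g j)
argmin {n} g P {i} Pi = go i Pi (<-wellFounded (g i))
  where
  go : ∀ i → P i ≡ true → Acc _<_ (g i) → Σ (Fin n) λ v → P v ≡ true × (∀ j → P j ≡ true → g v ≤ g j)
  go i Pi (acc rs) with Finₚ.any? (λ j → (P j Boolₚ.≟ true) ×-dec (g j <? g i))
  ... | yes (j , Pj , gj<gi) = go j Pj (rs gj<gi)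
  ... | no none = i , Pi , λ j Pj → ≮⇒≥ (λ gj<gi → none (j , Pj , gj<gi))

∈-tabulate⁺ : ∀ {n} (S : Fin n → Bool) {i} → S i ≡ true → i ∈ tabulate S
∈-tabulate⁺ S {i} Si = Vecₚ.lookup⇒[]= i (tabulate S) (trans (Vecₚ.lookup∘tabulate S i) Si)

∈-tabulate⁻ : ∀ {n} (S : Fin n → Bool) {i} → i ∈ tabulate S → S i ≡ true
∈-tabulate⁻ S {i} i∈S = trans (sym (Vecₚ.lookup∘tabulate S i)) (Vecₚ.[]=⇒lookup i∈S)

∣tabulate∣≡count : ∀ {n} (S : Fin n → Bool) → ∣ tabulate S ∣ ≡ count S
∣tabulate∣≡count {zero} S = refl
∣tabulate∣≡count {suc n} S with S zero
... | true = cong suc (∣tabulate∣≡count (S ∘ suc))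
... | false = ∣tabulate∣≡count (S ∘ suc)

2x[x+d]≤x²+[x+d]² : ∀ x d → 2 * (x * (x + d)) ≤ x * x + (x + d) * (x + d)
2x[x+d]≤x²+[x+d]² x d = subst (2 * (x * (x + d)) ≤_) (square-gap x d) (m≤m+n _ (d * d))
  where
  square-gap : ∀ x d → 2 * (x * (x + d)) + d * d ≡ x * x + (x + d) * (x + d)
  square-gap = solve-∀

2xy≤x²+y² : ∀ x y → 2 * (x * y) ≤ x * x + y * y
2xy≤x²+y² x y with ≤-total x y
... | inj₁ x≤y with m≤n⇒∃[o]m+o≡n x≤y
...   | d , refl = 2x[x+d]≤x²+[x+d]² x d
2xy≤x²+y² x y | inj₂ y≤x with m≤n⇒∃[o]m+o≡n y≤x
...   | d , refl = subst₂ _≤_ (cong (2 *_) (*-comm y x)) (+-comm (y * y) (x * x)) (2x[x+d]≤x²+[x+d]² y d)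

[a+b]²≤[1+L]S : ∀ L a b S S′ → a * a ≤ L * S′ → S′ + b * b ≤ S → (a + b) * (a + b) ≤ suc L * S
[a+b]²≤[1+L]S zero zero b S S′ _ S′+b²≤S = ≤-trans (≤-trans (m≤n+m (b * b) S′) S′+b²≤S) (m≤m+n S 0)
[a+b]²≤[1+L]S zero (suc _) _ _ _ () _
[a+b]²≤[1+L]S L@(suc _) a b S S′ a²≤LS′ S′+b²≤S = *-cancelˡ-≤ L (begin
    L * ((a + b) * (a + b))                                   ≡⟨ expand L a b ⟩
    L * (a * a) + 2 * (a * (L * b)) + L * (b * b)             ≤⟨ +-monoˡ-≤ (L * (b * b)) (+-monoʳ-≤ (L * (a * a)) (2xy≤x²+y² a (L * b))) ⟩
    L * (a * a) + (a * a + (L * b) * (L * b)) + L * (b * b)   ≡⟨ regroup L a b ⟩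
    suc L * (a * a) + L * suc L * (b * b)                     ≤⟨ +-monoˡ-≤ (L * suc L * (b * b)) (*-monoʳ-≤ (suc L) a²≤LS′) ⟩
    suc L * (L * S′) + L * suc L * (b * b)                    ≡⟨ factor L S′ (b * b) ⟩
    L * suc L * (S′ + b * b)                                  ≤⟨ *-monoʳ-≤ (L * suc L) S′+b²≤S ⟩
    L * suc L * S                                             ≡⟨ *-assoc L (suc L) S ⟩
    L * (suc L * S)                                           ∎)
  where
  open ≤-Reasoning
  expand : ∀ L a b → L * ((a + b) * (a + b)) ≡ L * (a * a) + 2 * (a * (L * b)) + L * (b * b)
  expand = solve-∀
  regroup : ∀ L a b → L * (a * a) + (a * a + (L * b) * (L * b)) + L * (b * b) ≡ suc L * (a * a) + L * suc L * (b * b)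
  regroup = solve-∀
  factor : ∀ L s t → suc L * (L * s) + L * suc L * t ≡ L * suc L * (s + t)
  factor = solve-∀

module Turán {n : ℕ} (E : Fin n → Fin n → Bool)
  (E-sym : ∀ i j → E i j ≡ E j i) (E-irrefl : ∀ i → E i i ≡ false) where

  deg : (Fin n → Bool) → Fin n → ℕ
  deg R i = count (R ∩ E i)

  degreeSum : (Fin n → Bool) → ℕ
  degreeSum R = ∑[ i ∈ R ] suc (deg R i)

  IndependentIn : ℕ → (Fin n → Bool) → Set
  IndependentIn k R = Σ (Fin k → Fin n) λ f →
    Injective _≡_ _≡_ f × (∀ a → R (f a) ≡ true) × (∀ a b → E (f a) (f b) ≡ false)

  module RemoveClosedNeighbourhood {R : Fin n → Bool} {v : Fin n} (Rv : R v ≡ true)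
    (v-min : ∀ j → R j ≡ true → deg R v ≤ deg R j) where

    δ = deg R v
    R′ = (R ─ v) ∖ E v

    R′⊆R : R′ ⊆ R
    R′⊆R j = ∖-⊆ R ⁅ v ⁆ j ∘ ∖-⊆ (R ─ v) (E v) j

    count-neighbours : count ((R ─ v) ∩ E v) ≡ δ
    count-neighbours = sumOver-cong (const 1) (─∩-absent R (E v) (E-irrefl v))

    count-R : count R ≡ count R′ + suc δ
    count-R = begin
      count R                                 ≡⟨ count-─ R Rv ⟩
      suc (count (R ─ v))                     ≡⟨ cong suc (sumOver-split (R ─ v) (E v) (const 1)) ⟩
      suc (count R′ + count ((R ─ v) ∩ E v))  ≡⟨ cong (λ c → suc (count R′ + c)) count-neighbours ⟩
      suc (count R′ + δ)                      ≡⟨ +-suc (count R′) δ ⟨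
      count R′ + suc δ                        ∎
      where open ≡-Reasoning

    degreeSum-R : degreeSum R′ + suc δ * suc δ ≤ degreeSum R
    degreeSum-R = begin
      degreeSum R′ + (suc δ + δ * suc δ)                 ≡⟨ regroup (degreeSum R′) (suc δ) (δ * suc δ) ⟩
      degreeSum R′ + δ * suc δ + suc δ                   ≤⟨ +-monoˡ-≤ (suc δ) (+-mono-≤ fewer-neighbours neighbours-have-degree≥δ) ⟩
      sumOver R′ w + sumOver ((R ─ v) ∩ E v) w + suc δ   ≡⟨ cong (_+ suc δ) (sumOver-split (R ─ v) (E v) w) ⟨
      sumOver (R ─ v) w + suc δ                          ≡⟨ cong (sumOver (R ─ v) w +_) (↾-member w R Rv) ⟨
      sumOver (R ─ v) w + (w ↾ R) v                      ≡⟨ sumOver-─ R v w ⟨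
      degreeSum R                                        ∎
      where
      open ≤-Reasoning
      w : Fin n → ℕ
      w j = suc (deg R j)
      regroup : ∀ a b c → a + (b + c) ≡ a + c + b
      regroup = solve-∀
      fewer-neighbours : degreeSum R′ ≤ sumOver R′ w
      fewer-neighbours = sumOver-mono-≤ {P = R′} (λ _ → id) λ j _ →
        s≤s (count-mono-≤ {P = R′ ∩ E j} {R ∩ E j} (∩-monoˡ (E j) R′⊆R))
      neighbours-have-degree≥δ : δ * suc δ ≤ sumOver ((R ─ v) ∩ E v) w
      neighbours-have-degree≥δ = begin
        δ * suc δ                        ≡⟨ cong (_* suc δ) count-neighbours ⟨
        count ((R ─ v) ∩ E v) * suc δ    ≡⟨ sumOver-const ((R ─ v) ∩ E v) (suc δ) ⟨
        ∑[ j ∈ (R ─ v) ∩ E v ] suc δ     ≤⟨ sumOver-mono-≤ {P = (R ─ v) ∩ E v} (λ _ → id) (λ j → s≤s ∘ v-min j ∘ neighbour∈R j) ⟩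
        sumOver ((R ─ v) ∩ E v) w        ∎
        where
        neighbour∈R : (R ─ v) ∩ E v ⊆ R
        neighbour∈R j = ∖-⊆ R ⁅ v ⁆ j ∘ ∩-⊆ˡ (R ─ v) (E v) j

    extend : ∀ {k} → IndependentIn k R′ → IndependentIn (suc k) R
    extend {k} (f , f-injective , f∈R′ , f-independent) = g , g-injective , g∈R , g-independent
      where
      f∈R─v : ∀ a → (R ─ v) (f a) ≡ true
      f∈R─v a = proj₁ (∖-member (R ─ v) (E v) (f∈R′ a))
      v≢f : ∀ a → v ≢ f a
      v≢f a = proj₂ (─-member R v (f∈R─v a))
      v≁f : ∀ a → E v (f a) ≡ false
      v≁f a = proj₂ (∖-member (R ─ v) (E v) (f∈R′ a))
      g : Fin (suc k) → Fin n
      g zero = v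
      g (suc a) = f a
      g-injective : Injective _≡_ _≡_ g
      g-injective {zero} {zero} _ = refl
      g-injective {zero} {suc b} v≡fb = ⊥-elim (v≢f b v≡fb)
      g-injective {suc a} {zero} fa≡v = ⊥-elim (v≢f a (sym fa≡v))
      g-injective {suc a} {suc b} fa≡fb = cong suc (f-injective fa≡fb)
      g∈R : ∀ a → R (g a) ≡ true
      g∈R zero = Rv
      g∈R (suc a) = R′⊆R (f a) (f∈R′ a)
      g-independent : ∀ a b → E (g a) (g b) ≡ false
      g-independent zero zero = E-irrefl v
      g-independent zero (suc b) = v≁f b
      g-independent (suc a) zero = trans (E-sym (f a) v) (v≁f a)
      g-independent (suc a) (suc b) = f-independent a b

  turán : ∀ L R → count R * count R ≤ L * degreeSum R ⊎ IndependentIn (suc L) R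
  removeMinimumDegree : ∀ L {R v} → R v ≡ true → (∀ j → R j ≡ true → deg R v ≤ deg R j) →
    count R * count R ≤ L * degreeSum R ⊎ IndependentIn (suc L) R

  turán L R with count R ≟ 0
  ... | yes empty = inj₁ (subst (λ c → c * c ≤ L * degreeSum R) (sym empty) z≤n)
  ... | no nonempty = let (v , Rv , v-min) = argmin (deg R) R (proj₂ (count-pos⇒∃ R (n≢0⇒n>0 nonempty))) in
    removeMinimumDegree L Rv v-min

  removeMinimumDegree zero {v = v} Rv _ = inj₂ ((λ _ → v) , (λ { {zero} {zero} _ → refl }) , (λ _ → Rv) , (λ _ _ → E-irrefl v))
  removeMinimumDegree (suc L) {R} Rv v-min = Sum.map
    (λ bound → subst (λ c → c * c ≤ suc L * degreeSum R) (sym count-R)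
      ([a+b]²≤[1+L]S L (count R′) (suc δ) (degreeSum R) (degreeSum R′) bound degreeSum-R))
    extend (turán L R′)
    where open RemoveClosedNeighbourhood Rv v-min

module Pruning {n : ℕ} (tr : Fin n → Fin n → Fin n → Bool)
  (tr-swap : ∀ i j m → tr i j m ≡ tr j i m) (tr-rotate : ∀ i j m → tr i j m ≡ tr j m i) where

  triplesAt : (Fin n → Bool) → Fin n → ℕ
  triplesAt S i = ∑[ j ∈ S ] ∑[ m ∈ S ] ⟦ tr i j m ⟧

  triples : (Fin n → Bool) → ℕ
  triples S = ∑[ i ∈ S ] triplesAt S i

  triples-─ : ∀ S p → triples S ≤ triples (S ─ p) + 3 * triplesAt S p
  triples-─ S p = begin
    triples S                                              ≤⟨ sumOver-─≤ S p (triplesAt S) ⟩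
    ∑[ i ∈ S′ ] triplesAt S i + T
      ≤⟨ +-monoˡ-≤ T (sumOver-mono-≤ {P = S′} (λ _ → id) (λ i _ → triplesAt-─ i)) ⟩
    ∑[ i ∈ S′ ] (triplesAt S′ i + X i + Y i) + T
      ≡⟨ cong (_+ T) (trans (sumOver-+ S′ _ Y) (cong (_+ sumOver S′ Y) (sumOver-+ S′ (triplesAt S′) X))) ⟩
    triples S′ + sumOver S′ X + sumOver S′ Y + T           ≤⟨ +-monoˡ-≤ T (+-mono-≤ (+-monoʳ-≤ (triples S′) X≤T) Y≤T) ⟩
    triples S′ + T + T + T                                 ≡⟨ regroup (triples S′) T ⟩
    triples S′ + 3 * T                                     ∎
    where
    open ≤-Reasoning
    S′ = S ─ p
    T = triplesAt S p
    X Y : Fin n → ℕ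
    X i = ∑[ j ∈ S′ ] ⟦ tr i j p ⟧
    Y i = ∑[ m ∈ S ] ⟦ tr i p m ⟧
    regroup : ∀ a b → a + b + b + b ≡ a + 3 * b
    regroup = solve-∀
    triplesAt-─ : ∀ i → triplesAt S i ≤ triplesAt S′ i + X i + Y i
    triplesAt-─ i = begin
      triplesAt S i                                        ≤⟨ sumOver-─≤ S p (λ j → ∑[ m ∈ S ] ⟦ tr i j m ⟧) ⟩
      ∑[ j ∈ S′ ] ∑[ m ∈ S ] ⟦ tr i j m ⟧ + Y i
        ≤⟨ +-monoˡ-≤ (Y i) (sumOver-mono-≤ {P = S′} (λ _ → id) (λ j _ → sumOver-─≤ S p (λ m → ⟦ tr i j m ⟧))) ⟩
      ∑[ j ∈ S′ ] (∑[ m ∈ S′ ] ⟦ tr i j m ⟧ + ⟦ tr i j p ⟧) + Y i  ≡⟨ cong (_+ Y i) (sumOver-+ S′ _ _) ⟩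
      triplesAt S′ i + X i + Y i                            ∎
    X≤T : sumOver S′ X ≤ T
    X≤T = sumOver-mono-≤ (∖-⊆ S ⁅ p ⁆) λ i _ →
      sumOver-mono-≤ (∖-⊆ S ⁅ p ⁆) λ j _ → ≤-reflexive (cong ⟦_⟧ (sym (tr-rotate p i j)))
    Y≤T : sumOver S′ Y ≤ T
    Y≤T = sumOver-mono-≤ (∖-⊆ S ⁅ p ⁆) λ i _ →
      sumOver-mono-≤ {P = S} (λ _ → id) λ m _ → ≤-reflexive (cong ⟦_⟧ (tr-swap i p m))

  prune : ∀ (M N : ℕ) S → Σ (Fin n → Bool) λ S′ →
    (∀ p → S′ p ≡ true → N ≤ M * (3 * triplesAt S′ p)) × (M * triples S ≤ M * triples S′ + N * count S)
  prune M N S = go S (<-wellFounded (count S))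
    where
    go : ∀ S → Acc _<_ (count S) → Σ (Fin n → Bool) λ S′ →
      (∀ p → S′ p ≡ true → N ≤ M * (3 * triplesAt S′ p)) × (M * triples S ≤ M * triples S′ + N * count S)
    go S (acc rs) with Finₚ.any? (λ p → (S p Boolₚ.≟ true) ×-dec (M * (3 * triplesAt S p) <? N))
    ... | no none = S , (λ p Sp → ≮⇒≥ (λ few → none (p , Sp , few))) , m≤m+n _ _
    ... | yes (p , Sp , few) with go (S ─ p) (rs (≤-reflexive (sym (count-─ S Sp))))
    ...   | S′ , dense , bound = S′ , dense , (begin
      M * triples S                                   ≤⟨ *-monoʳ-≤ M (triples-─ S p) ⟩
      M * (triples (S ─ p) + 3 * triplesAt S p)       ≡⟨ *-distribˡ-+ M _ _ ⟩
      M * triples (S ─ p) + M * (3 * triplesAt S p)   ≤⟨ +-mono-≤ bound (<⇒≤ few) ⟩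
      M * triples S′ + N * count (S ─ p) + N          ≡⟨ +-assoc (M * triples S′) _ N ⟩
      M * triples S′ + (N * count (S ─ p) + N)        ≡⟨ cong (M * triples S′ +_) (trans (+-comm _ N) (sym (*-suc N _))) ⟩
      M * triples S′ + N * suc (count (S ─ p))        ≡⟨ cong (λ c → M * triples S′ + N * c) (count-─ S Sp) ⟨
      M * triples S′ + N * count S                    ∎)
      where open ≤-Reasoning

module PointConfiguration {c : Level} (F : OrderedField c) {n : ℕ} (A : Fin n → Geometry.Point F)
  (A-injective : Injective _≡_ _≡_ A) where
  open Geometry F
  open PlaneGeometry F

  Triple : Fin n → Fin n → Fin n → Set c
  Triple i j m = i ≢ j × i ≢ m × j ≢ m × Col (A i) (A j) (A m)

  triple? : ∀ i j m → Dec (Triple i j m)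
  triple? i j m = ¬? (i Fin.≟ j) ×-dec ¬? (i Fin.≟ m) ×-dec ¬? (j Fin.≟ m) ×-dec col? (A i) (A j) (A m)

  triple : Fin n → Fin n → Fin n → Bool
  triple i j m = does (triple? i j m)

  triple-swap : ∀ i j m → triple i j m ≡ triple j i m
  triple-swap i j m = does-⇔ (mk⇔ swap swap) (triple? i j m) (triple? j i m)
    where
    swap : ∀ {i j m} → Triple i j m → Triple j i m
    swap (i≢j , i≢m , j≢m , col) = ≢-sym i≢j , j≢m , i≢m , Col-swap col

  triple-rotate : ∀ i j m → triple i j m ≡ triple j m i
  triple-rotate i j m = does-⇔ (mk⇔ rotate (rotate ∘ rotate)) (triple? i j m) (triple? j m i)
    where
    rotate : ∀ {i j m} → Triple i j m → Triple j m i
    rotate (i≢j , i≢m , j≢m , col) = j≢m , ≢-sym i≢j , ≢-sym i≢m , Col-rotate col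

  open Pruning triple triple-swap triple-rotate public

  hasThirdPoint : Fin n → Fin n → Bool
  hasThirdPoint i j = does (0 <? count (triple i j))

  hasThirdPoint-sym : ∀ i j → hasThirdPoint i j ≡ hasThirdPoint j i
  hasThirdPoint-sym i j = cong (λ c → does (0 <? c)) (sumOver-cong (const 1) (triple-swap i j))

  no-triple-with-repeat : ∀ i m → triple i i m ≡ false
  no-triple-with-repeat i m = dec-false (triple? i i m) λ (i≢i , _) → i≢i refl

  count-triple-repeat : ∀ i → count (triple i i) ≡ 0
  count-triple-repeat i = trans (sumOver-cong (const 1) (no-triple-with-repeat i)) (sum-replicate-zero n)

  hasThirdPoint-irrefl : ∀ i → hasThirdPoint i i ≡ false
  hasThirdPoint-irrefl i = cong (λ c → does (0 <? c)) (count-triple-repeat i)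

  open Turán hasThirdPoint hasThirdPoint-sym hasThirdPoint-irrefl

  everything : Fin n → Bool
  everything _ = true

  count-everything : count everything ≡ n
  count-everything = trans (sum-const n 1) (*-identityʳ n)

  A-≢ : ∀ {i j} → i ≢ j → A i ≢ A j
  A-≢ i≢j = i≢j ∘ A-injective

  no-third-point⇒visible : ∀ {i j} → i ≢ j → hasThirdPoint i j ≡ false → Visible A (A i) (A j)
  no-third-point⇒visible {i} {j} i≢j no-third (r , between) =
    does-false⇒ (0 <? count (triple i j)) no-third (member⇒count-pos (triple i j) ijr)
    where
    r≢ = InOpenSeg⇒≢ (A-≢ i≢j) between
    ijr : triple i j r ≡ true
    ijr = dec-true (triple? i j r)
      (i≢j , (λ i≡r → proj₁ r≢ (cong A (sym i≡r))) , (λ j≡r → proj₂ r≢ (cong A (sym j≡r))) , InOpenSeg⇒Col between)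

  no-independent-set : ∀ {k} → NoLMutuallyVisible k A → ¬ IndependentIn k everything
  no-independent-set noL (f , f-injective , _ , independent) =
    noL f f-injective λ a b a≢b → no-third-point⇒visible (a≢b ∘ f-injective) (independent a b)

  degreeSum≤ : degreeSum everything ≤ n + triples everything
  degreeSum≤ = begin
    ∑[ i < n ] suc (∑[ j < n ] ⟦ hasThirdPoint i j ⟧)        ≤⟨ sum-mono-≤ (λ i → s≤s (sum-mono-≤ (λ j → ⟦0<?⟧≤ (count (triple i j))))) ⟩
    ∑[ i < n ] (1 + triplesAt everything i)                  ≡⟨ ∑-distrib-+ (const 1) (triplesAt everything) ⟩
    count everything + triples everything                    ≡⟨ cong (_+ triples everything) count-everything ⟩
    n + triples everything                                   ∎
    where open ≤-Reasoning

  turán-bound : ∀ {L} → NoLMutuallyVisible (suc L) A → n * n ≤ L * (n + triples everything)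
  turán-bound {L} noL with turán L everything
  ... | inj₁ bound = subst (λ c → c * c ≤ L * (n + triples everything)) count-everything (≤-trans bound (*-monoʳ-≤ L degreeSum≤))
  ... | inj₂ independent = ⊥-elim (no-independent-set noL independent)

  collinear : Fin n → Fin n → Fin n → Bool
  collinear i j m = does (col? (A i) (A j) (A m))

  collinear-first : ∀ i j → collinear i j i ≡ true
  collinear-first i j = dec-true (col? (A i) (A j) (A i)) (Col-first (A i) (A j))

  collinear-second : ∀ i j → collinear i j j ≡ true
  collinear-second i j = dec-true (col? (A i) (A j) (A j)) (Col-second (A i) (A j))

  module _ {k} (noK : NoKCollinear k A) where
    open ≤-Reasoning

    collinear-count : ∀ {i j} → i ≢ j → count (collinear i j) < k
    collinear-count {i} {j} i≢j with k ≤? count (collinear i j)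
    ... | no k≰count = ≰⇒> k≰count
    ... | yes k≤count = let (f , f-injective , on-line) = ≤count⇒injection (collinear i j) k≤count in
      ⊥-elim (noK f f-injective (Col⇒CollinearFam (A-≢ i≢j) λ a → does-true⇒ (col? _ _ _) (on-line a)))

    otherPoints-count : ∀ {i j} → i ≢ j → count (collinear i j ─ i) ≤ k ∸ 2
    otherPoints-count {i} {j} i≢j = m+n≤o⇒m≤o∸n _ (begin
      count (collinear i j ─ i) + 2       ≡⟨ +-comm _ 2 ⟩
      suc (suc (count (collinear i j ─ i)))  ≡⟨ cong suc (count-─ (collinear i j) (collinear-first i j)) ⟨
      suc (count (collinear i j))         ≤⟨ collinear-count i≢j ⟩
      k                                   ∎)

    thirdPoints⊆ : ∀ {i j} → triple i j ⊆ (collinear i j ─ i ─ j)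
    thirdPoints⊆ {i} {j} m ijm = let (_ , i≢m , j≢m , col) = does-true⇒ (triple? i j m) ijm in
      ─-intro (collinear i j ─ i) (─-intro (collinear i j) (dec-true (col? _ _ _) col) i≢m) j≢m

    thirdPoints-count : ∀ i j → count (triple i j) ≤ k ∸ 3
    thirdPoints-count i j = case i Fin.≟ j of λ where
      (yes refl) → ≤-trans (≤-reflexive (count-triple-repeat i)) z≤n
      (no i≢j) → m+n≤o⇒m≤o∸n _ (begin
        count (triple i j) + 3                          ≡⟨ +-comm _ 3 ⟩
        suc (suc (suc (count (triple i j))))            ≤⟨ s≤s (s≤s (s≤s (count-mono-≤ thirdPoints⊆))) ⟩
        suc (suc (suc (count (collinear i j ─ i ─ j))))
          ≡⟨ cong (λ c → suc (suc c)) (count-─ (collinear i j ─ i) (─-intro (collinear i j) (collinear-second i j) i≢j)) ⟨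
        suc (suc (count (collinear i j ─ i)))           ≡⟨ cong suc (count-─ (collinear i j) (collinear-first i j)) ⟨
        suc (count (collinear i j))                     ≤⟨ collinear-count i≢j ⟩
        k                                               ∎)

    triples-bound : ∀ S → triples S ≤ count S * (n * (k ∸ 3))
    triples-bound S = begin
      triples S                   ≤⟨ sumOver-mono-≤ {P = S} (λ _ → id) (λ i _ → triplesAt≤ i) ⟩
      ∑[ i ∈ S ] (n * (k ∸ 3))    ≡⟨ sumOver-const S _ ⟩
      count S * (n * (k ∸ 3))     ∎
      where
      triplesAt≤ : ∀ i → triplesAt S i ≤ n * (k ∸ 3)
      triplesAt≤ i = begin
        ∑[ j ∈ S ] ∑[ m ∈ S ] ⟦ triple i j m ⟧   ≤⟨ sumOver≤sum S _ ⟩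
        ∑[ j < n ] ∑[ m ∈ S ] ⟦ triple i j m ⟧   ≤⟨ sum-mono-≤ (λ j → ≤-trans (sumOver≤sum S _) (thirdPoints-count i j)) ⟩
        ∑[ j < n ] (k ∸ 3)                        ≡⟨ sum-const n _ ⟩
        n * (k ∸ 3)                               ∎

  module RichLinesThrough (S : Fin n → Bool) (p : Fin n) where

    lineHasThirdPoint : Fin n → Bool
    lineHasThirdPoint j = does (0 <? count (S ∩ triple p j))

    rich : Fin n → Bool
    rich = S ∩ lineHasThirdPoint

    EarlierRichOnLine : Fin n → Fin n → Set c
    EarlierRichOnLine j j′ = toℕ j′ < toℕ j × rich j′ ≡ true × Col (A p) (A j′) (A j)

    earlierRichOnLine? : ∀ j j′ → Dec (EarlierRichOnLine j j′)
    earlierRichOnLine? j j′ = (toℕ j′ <? toℕ j) ×-dec (rich j′ Boolₚ.≟ true) ×-dec col? (A p) (A j′) (A j)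

    -- each rich line through p is represented by its rich point of least index
    representative : Fin n → Bool
    representative j = rich j ∧ not (does (Finₚ.any? (earlierRichOnLine? j)))

    rich-third : ∀ {j} → rich j ≡ true → ∃ λ m → S m ≡ true × Triple p j m
    rich-third {j} rj =
      let (m , third) = count-pos⇒∃ (S ∩ triple p j) (does-true⇒ (0 <? _) (proj₂ (∧-true⁻ rj)))
          (Sm , pjm) = ∧-true⁻ third
      in m , Sm , does-true⇒ (triple? p j m) pjm

    rich⇒≢ : ∀ {j} → rich j ≡ true → p ≢ j
    rich⇒≢ rj = let (_ , _ , p≢j , _) = rich-third rj in p≢j

    representative-exists : ∀ {j} → rich j ≡ true → ∃ λ r → representative r ≡ true × Col (A p) (A r) (A j)
    representative-exists {j} rj = first-is-representative (argmin toℕ onLine (∧-true rj (collinear-second p j)))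
      where
      onLine : Fin n → Bool
      onLine = rich ∩ λ r → collinear p r j
      first-is-representative : (Σ (Fin n) λ r → onLine r ≡ true × (∀ j′ → onLine j′ ≡ true → toℕ r ≤ toℕ j′)) →
        ∃ λ r → representative r ≡ true × Col (A p) (A r) (A j)
      first-is-representative (r , r-onLine , r-first) =
        r , ∧-true r-rich (cong not (dec-false (Finₚ.any? (earlierRichOnLine? r)) unblocked)) , prj
        where
        r-rich : rich r ≡ true
        r-rich = proj₁ (∧-true⁻ r-onLine)
        prj : Col (A p) (A r) (A j)
        prj = does-true⇒ (col? (A p) (A r) (A j)) (proj₂ (∧-true⁻ r-onLine))
        unblocked : ¬ ∃ (EarlierRichOnLine r)
        unblocked (j′ , j′<r , j′-rich , pj′r) =
          <⇒≱ j′<r (r-first j′ (∧-true j′-rich (dec-true (col? (A p) (A j′) (A j)) pj′j)))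
          where
          pj′j : Col (A p) (A j′) (A j)
          pj′j = Col-trans (A-≢ (rich⇒≢ r-rich)) (Col-rotate (Col-swap pj′r)) prj

    no-earlier-rich-on-line : ∀ {r r′} → representative r′ ≡ true → toℕ r < toℕ r′ → rich r ≡ true →
      ¬ Col (A p) (A r) (A r′)
    no-earlier-rich-on-line {r} {r′} rep′ r<r′ r-rich prr′ =
      does-false⇒ (Finₚ.any? (earlierRichOnLine? r′)) (not-true (proj₂ (∧-true⁻ rep′))) (r , r<r′ , r-rich , prr′)

    representatives-not-collinear : ∀ {r r′} → representative r ≡ true → representative r′ ≡ true → r ≢ r′ →
      ¬ Col (A p) (A r) (A r′)
    representatives-not-collinear {r} {r′} rep rep′ r≢r′ prr′ with Finₚ.<-cmp r r′
    ... | tri< r<r′ _ _ = no-earlier-rich-on-line rep′ r<r′ (proj₁ (∧-true⁻ rep)) prr′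
    ... | tri≈ _ r≡r′ _ = r≢r′ r≡r′
    ... | tri> _ _ r′<r = no-earlier-rich-on-line rep r′<r (proj₁ (∧-true⁻ rep′)) (Col-rotate (Col-swap prr′))

    rich≤representatives : count rich ≤ ∑[ r ∈ representative ] count (collinear p r ─ p)
    rich≤representatives = begin
      ∑[ j < n ] ⟦ rich j ⟧                                               ≤⟨ sum-mono-≤ (λ j → ⟦⟧≤ (covered j)) ⟩
      ∑[ j < n ] ∑[ r ∈ representative ] ⟦ (collinear p r ─ p) j ⟧        ≡⟨ sum-sumOver-comm representative (λ j r → ⟦ (collinear p r ─ p) j ⟧) ⟩
      ∑[ r ∈ representative ] count (collinear p r ─ p)                   ∎
      where
      open ≤-Reasoning
      covered : ∀ j → rich j ≡ true → 1 ≤ ∑[ r ∈ representative ] ⟦ (collinear p r ─ p) j ⟧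
      covered j rj = ≤-trans (≤-reflexive (sym (trans (↾-member w representative rep) (cong ⟦_⟧ on-line))))
        (term≤sum (w ↾ representative) r)
        where
        w : Fin n → ℕ
        w r = ⟦ (collinear p r ─ p) j ⟧
        r = proj₁ (representative-exists rj)
        rep = proj₁ (proj₂ (representative-exists rj))
        on-line : (collinear p r ─ p) j ≡ true
        on-line = ─-intro (collinear p r) (dec-true (col? (A p) (A r) (A j)) (proj₂ (proj₂ (representative-exists rj)))) (rich⇒≢ rj)

    triplesAt-bound : ∀ {k} → NoKCollinear k A → triplesAt S p ≤ count representative * ((k ∸ 2) * (k ∸ 3))
    triplesAt-bound {k} noK = begin
      triplesAt S p                                                   ≤⟨ sumOver-mono-≤ {P = S} (λ _ → id) thirdPoints-if-rich ⟩
      ∑[ j ∈ S ] (const (k ∸ 3) ↾ lineHasThirdPoint) j                ≡⟨ sumOver-∩ S lineHasThirdPoint (const (k ∸ 3)) ⟨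
      ∑[ j ∈ rich ] (k ∸ 3)                                           ≡⟨ sumOver-const rich (k ∸ 3) ⟩
      count rich * (k ∸ 3)                                            ≤⟨ *-monoˡ-≤ (k ∸ 3) rich≤representatives ⟩
      (∑[ r ∈ representative ] count (collinear p r ─ p)) * (k ∸ 3)   ≤⟨ *-monoˡ-≤ (k ∸ 3) (sumOver-mono-≤ {P = representative} (λ _ → id) line-bound) ⟩
      (∑[ r ∈ representative ] (k ∸ 2)) * (k ∸ 3)                     ≡⟨ cong (_* (k ∸ 3)) (sumOver-const representative (k ∸ 2)) ⟩
      count representative * (k ∸ 2) * (k ∸ 3)                        ≡⟨ *-assoc (count representative) (k ∸ 2) (k ∸ 3) ⟩
      count representative * ((k ∸ 2) * (k ∸ 3))                      ∎
      where
      open ≤-Reasoning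
      thirdPoints-if-rich : ∀ j → S j ≡ true →
        ∑[ m ∈ S ] ⟦ triple p j m ⟧ ≤ (const (k ∸ 3) ↾ lineHasThirdPoint) j
      thirdPoints-if-rich j _ = subst (_≤ (const (k ∸ 3) ↾ lineHasThirdPoint) j) (sym (sumOver-⟦⟧ S (triple p j)))
        (≤-if-positive (≤-trans (count-mono-≤ (∩-⊆ʳ S (triple p j))) (thirdPoints-count noK p j)))
      line-bound : ∀ r → representative r ≡ true → count (collinear p r ─ p) ≤ k ∸ 2
      line-bound r rep = otherPoints-count noK (rich⇒≢ (proj₁ (∧-true⁻ rep)))

    incidentRichLines : IncidentRichLines A (tabulate S) p (count representative)
    incidentRichLines =
      b , third , (λ a → ∈-tabulate⁺ S (b∈S a)) , (λ a → ∈-tabulate⁺ S (third∈S a)) ,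
      (λ a → ≢-sym (proj₁ (triple-at a))) , (λ a → ≢-sym (proj₁ (proj₂ (triple-at a)))) ,
      (λ a → proj₁ (proj₂ (proj₂ (triple-at a)))) ,
      (λ a → Col⇒Collinear3 (A-≢ (proj₁ (triple-at a))) (proj₂ (proj₂ (proj₂ (triple-at a))))) ,
      (λ a a′ a≢a′ c3 → representatives-not-collinear (b-rep a) (b-rep a′) (a≢a′ ∘ b-injective) (Collinear3⇒Col c3))
      where
      enumeration = ≤count⇒injection representative ≤-refl
      b = proj₁ enumeration
      b-injective = proj₁ (proj₂ enumeration)
      b-rep = proj₂ (proj₂ enumeration)
      b-rich : ∀ a → rich (b a) ≡ true
      b-rich a = proj₁ (∧-true⁻ (b-rep a))
      b∈S : ∀ a → S (b a) ≡ true
      b∈S a = proj₁ (∧-true⁻ (b-rich a))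
      third : Fin (count representative) → Fin n
      third a = proj₁ (rich-third (b-rich a))
      third∈S : ∀ a → S (third a) ≡ true
      third∈S a = proj₁ (proj₂ (rich-third (b-rich a)))
      triple-at : ∀ a → Triple p (b a) (third a)
      triple-at a = proj₂ (proj₂ (rich-third (b-rich a)))

2*[nC2]≡n*[n∸1] : ∀ n → 2 * (n C 2) ≡ n * (n ∸ 1)
2*[nC2]≡n*[n∸1] zero = refl
2*[nC2]≡n*[n∸1] (suc zero) = refl
2*[nC2]≡n*[n∸1] (suc (suc m)) = begin
  2 * (suc (suc m) C 2)          ≡⟨ cong (2 *_) (nCk+nC[k+1]≡[n+1]C[k+1] (suc m) 1) ⟨
  2 * (suc m C 1 + suc m C 2)    ≡⟨ cong (λ c → 2 * (c + suc m C 2)) (nC1≡n (suc m)) ⟩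
  2 * (suc m + suc m C 2)        ≡⟨ *-distribˡ-+ 2 (suc m) _ ⟩
  2 * suc m + 2 * (suc m C 2)    ≡⟨ cong (2 * suc m +_) (2*[nC2]≡n*[n∸1] (suc m)) ⟩
  2 * suc m + suc m * m          ≡⟨ regroup m ⟩
  suc (suc m) * suc m            ∎
  where
  open ≡-Reasoning
  regroup : ∀ m → 2 * suc m + suc m * m ≡ suc (suc m) * suc m
  regroup = solve-∀

incidence-arith : ∀ {n L T r a C} → 2 * C ≡ suc a * a →
  n ≤ 4 * L * (3 * T) → T ≤ r * (suc a * a) → n ≤ r * (24 * L * C)
incidence-arith {n} {L} {T} {r} {a} {C} 2C≡ n≤12LT T≤ = begin
  n                               ≤⟨ n≤12LT ⟩
  4 * L * (3 * T)                 ≤⟨ *-monoʳ-≤ (4 * L) (*-monoʳ-≤ 3 T≤) ⟩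
  4 * L * (3 * (r * (suc a * a))) ≡⟨ cong (λ x → 4 * L * (3 * (r * x))) 2C≡ ⟨
  4 * L * (3 * (r * (2 * C)))     ≡⟨ regroup L r C ⟩
  r * (24 * L * C)                ∎
  where
  open ≤-Reasoning
  regroup : ∀ L r C → 4 * L * (3 * (r * (2 * C))) ≡ r * (24 * L * C)
  regroup = solve-∀

large-subset-arith : ∀ {n L Φ₀ Φ s a C} → 2 * C ≡ suc a * a →
  n * n ≤ L * (n + Φ₀) → 4 * L * Φ₀ ≤ 4 * L * Φ + n * n → Φ ≤ s * (n * a) → 4 * L ≤ n →
  n ≤ s * (8 * L * C)
large-subset-arith {zero} _ _ _ _ _ = z≤n
large-subset-arith {n@(suc _)} {L} {Φ₀} {Φ} {s} {a} {C} 2C≡ turán pruned Φ≤ 4L≤n = begin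
  n                        ≤⟨ m≤m+n n n ⟩
  n + n                    ≡⟨ cong (n +_) (+-identityʳ n) ⟨
  2 * n                    ≤⟨ *-cancelˡ-≤ n (begin
    n * (2 * n)              ≡⟨ double n ⟩
    2 * (n * n)              ≤⟨ 2n²≤4LΦ ⟩
    4 * L * Φ                ≤⟨ *-monoʳ-≤ (4 * L) Φ≤ ⟩
    4 * L * (s * (n * a))    ≡⟨ pull-n L s n a ⟩
    n * (4 * L * s * a)      ∎) ⟩
  4 * L * s * a            ≤⟨ m≤m*n (4 * L * s * a) (suc a) ⟩
  4 * L * s * a * suc a    ≡⟨ trans (*-assoc (4 * L * s) a (suc a)) (cong (4 * L * s *_) (trans (*-comm a (suc a)) (sym 2C≡))) ⟩
  4 * L * s * (2 * C)      ≡⟨ regroup L s C ⟩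
  s * (8 * L * C)          ∎
  where
  open ≤-Reasoning
  double : ∀ n → n * (2 * n) ≡ 2 * (n * n)
  double = solve-∀
  pull-n : ∀ L s n a → 4 * L * (s * (n * a)) ≡ n * (4 * L * s * a)
  pull-n = solve-∀
  regroup : ∀ L s C → 4 * L * s * (2 * C) ≡ s * (8 * L * C)
  regroup = solve-∀
  split : ∀ L n Φ₀ → 4 * (L * (n + Φ₀)) ≡ 4 * L * n + 4 * L * Φ₀
  split = solve-∀
  twice : ∀ x → 2 * x + 2 * x ≡ 4 * x
  twice = solve-∀
  collect : ∀ x y → x + (y + x) ≡ 2 * x + y
  collect = solve-∀
  2n²≤4LΦ : 2 * (n * n) ≤ 4 * L * Φ
  2n²≤4LΦ = +-cancelˡ-≤ (2 * (n * n)) _ _ (begin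
    2 * (n * n) + 2 * (n * n)              ≡⟨ twice (n * n) ⟩
    4 * (n * n)                            ≤⟨ *-monoʳ-≤ 4 turán ⟩
    4 * (L * (n + Φ₀))                     ≡⟨ split L n Φ₀ ⟩
    4 * L * n + 4 * L * Φ₀                 ≤⟨ +-mono-≤ (*-monoˡ-≤ n 4L≤n) pruned ⟩
    n * n + (4 * L * Φ + n * n)            ≡⟨ collect (n * n) (4 * L * Φ) ⟩
    2 * (n * n) + 4 * L * Φ                ∎)

proposition11p1 : {c : Level} (F : OrderedField c) (k l n : ℕ) →
    4 ≤ k → 2 ≤ l →
    (A : Fin n → Geometry.Point F) → Injective _≡_ _≡_ A →
    Geometry.NoKCollinear F k A →
    Geometry.NoLMutuallyVisible F l A →
    4 * (l ∸ 1) ≤ n →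
    Σ (Subset n) λ A' →
      (n ≤ ∣ A' ∣ * (8 * (l ∸ 1) * ((k ∸ 2) C 2))) ×
      (∀ i → i ∈ A' → Σ ℕ λ m →
        (n ≤ m * (24 * (l ∸ 1) * ((k ∸ 2) C 2))) ×
        Geometry.IncidentRichLines F A A' i m)
-- the bounds on k and l serve only to make k ∸ 2 ≡ suc (k ∸ 3) and l ≡ suc (l ∸ 1) hold definitionally
proposition11p1 F k l n (s≤s (s≤s (s≤s (s≤s _)))) (s≤s (s≤s _)) A A-injective noK noL 4L≤n =
  tabulate S , A′-large , λ p p∈S → count (representative S p) , many-rich-lines p p∈S , incidentRichLines S p
  where
  open PointConfiguration F A A-injective
  open RichLinesThrough
  L = l ∸ 1
  pruned = prune (4 * L) n everything
  S = proj₁ pruned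
  2C≡ : 2 * ((k ∸ 2) C 2) ≡ (k ∸ 2) * (k ∸ 3)
  2C≡ = 2*[nC2]≡n*[n∸1] (k ∸ 2)
  kept : 4 * L * triples everything ≤ 4 * L * triples S + n * n
  kept = subst (λ c → 4 * L * triples everything ≤ 4 * L * triples S + n * c) count-everything (proj₂ (proj₂ pruned))
  A′-large : n ≤ ∣ tabulate S ∣ * (8 * L * ((k ∸ 2) C 2))
  A′-large = subst (λ s → n ≤ s * (8 * L * ((k ∸ 2) C 2))) (sym (∣tabulate∣≡count S))
    (large-subset-arith {Φ = triples S} {s = count S} {a = k ∸ 3} 2C≡ (turán-bound noL) kept (triples-bound noK S) 4L≤n)
  many-rich-lines : ∀ p → p ∈ tabulate S → n ≤ count (representative S p) * (24 * L * ((k ∸ 2) C 2))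
  many-rich-lines p p∈S = incidence-arith {n} {L} {triplesAt S p} {count (representative S p)} {k ∸ 3} {(k ∸ 2) C 2}
    2C≡ (proj₁ (proj₂ pruned) p (∈-tabulate⁻ S p∈S)) (triplesAt-bound S p {k} noK)
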